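{- Let $H'$ be the digraph with $V(H')=\{1,2\}$ and $A(H')=\{(1,2)\}$. A graph is a difference graph if and only if it is $H'$-threshold.
   Context: Graphs are finite, simple, undirected. A 2-partitioned graph is $(G,A_1,A_2)$ with $(A_1,A_2)$ a partition of $V(G)$ (parts may be empty). For a digraph $H$ on $\{1,2\}$, $(G,A_1,A_2)\circ_H(F,B_1,B_2)=(R,A_1\cup B_1,A_2\cup B_2)$ with $V(R)=V(G)\cup V(F)$ (disjoint union) and $E(R)=E(G)\cup E(F)\cup\{xy:x\in A_i,y\in B_j,(i,j)\in A(H)\}$. $K^2_i$ is the 2-partitioned graph with a single vertex in the $i$-th part. A graph $G$ is $H$-threshold if it is the underlying graph of $K^2_{i_1}\circ_H\cdots\circ_H K^2_{i_m}$ for some $i_1,\dots,i_m\in\{1,2\}$ (distinct vertices). A difference graph is a graph $G$ whose vertex set has a partition $(A,B)$ into two independent sets (possibly empty) such that the sets $\{N_A(b):b\in B\}$ are totally ordered by inclusion and the sets $\{N_B(a):a\in A\}$ are totally ordered by inclusion, where $N_X(x)=\{y\in X:xy\in E(G)\}$. -}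

module Defs where

open import Data.Nat using (ℕ; zero; suc; _+_)
open import Data.Fin using (Fin; zero; suc; splitAt)
open import Data.Bool using (Bool; true; false)
open import Data.Sum using (_⊎_; inj₁; inj₂)
open import Data.Product using (Σ; ∃; _×_)
open import Data.List using (List; foldl)
open import Relation.Binary.PropositionalEquality using (_≡_)
open import Function.Bundles using (_⤖_; Bijection)

record Graph : Set where
  field
    n      : ℕ
    adj    : Fin n → Fin n → Bool
    sym    : ∀ x y → adj x y ≡ adj y x
    irrefl : ∀ x → adj x x ≡ false

open Graph public

-- A digraph on {1,2}; part 1 is  zero : Fin 2, part 2 is  suc zero.
Digraph₂ : Set
Digraph₂ = Fin 2 → Fin 2 → Bool

-- 2-partitioned graph (only the adjacency and the part assignment
-- are needed to define the operation and its underlying graph).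
record PGraph : Set where
  field
    size : ℕ
    padj : Fin size → Fin size → Bool
    part : Fin size → Fin 2

open PGraph public

compose : Digraph₂ → PGraph → PGraph → PGraph
compose H G F = record { size = size G + size F ; padj = a ; part = p }
  where
  p : Fin (size G + size F) → Fin 2
  p x with splitAt (size G) x
  ... | inj₁ u = part G u
  ... | inj₂ v = part F v
  a : Fin (size G + size F) → Fin (size G + size F) → Bool
  a x y with splitAt (size G) x | splitAt (size G) y
  ... | inj₁ u | inj₁ u' = padj G u u'
  ... | inj₂ v | inj₂ v' = padj F v v'
  ... | inj₁ u | inj₂ v  = H (part G u) (part F v)
  ... | inj₂ v | inj₁ u  = H (part G u) (part F v)

K : Fin 2 → PGraph
K i = record { size = 1 ; padj = λ _ _ → false ; part = λ _ → i }

Empty : PGraph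
Empty = record { size = 0 ; padj = λ () ; part = λ () }

threshold : Digraph₂ → List (Fin 2) → PGraph
threshold H is = foldl (λ acc i → compose H acc (K i)) Empty is

_≅U_ : Graph → PGraph → Set
G ≅U P = Σ (Fin (n G) ⤖ Fin (size P)) λ f →
  ∀ x y → adj G x y ≡ padj P (Bijection.to f x) (Bijection.to f y)

IsThreshold : Digraph₂ → Graph → Set
IsThreshold H G = ∃ λ (is : List (Fin 2)) → G ≅U threshold H is

-- Difference graph: partition (A,B) via side (A = zero, B = suc zero),
-- both parts independent, neighbourhoods on each side totally ordered by ⊆.

IsDifference : Graph → Set
IsDifference G = ∃ λ (side : Fin (n G) → Fin 2) →
    (∀ x y → side x ≡ side y → adj G x y ≡ false)
  × (∀ b b' → side b ≡ suc zero → side b' ≡ suc zero →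
        NA side b b' ⊎ NA side b' b)
  × (∀ a a' → side a ≡ zero → side a' ≡ zero →
        NB side a a' ⊎ NB side a' a)
  where
  NA : (Fin (n G) → Fin 2) → Fin (n G) → Fin (n G) → Set
  NA side b b' = ∀ a → side a ≡ zero → adj G b a ≡ true → adj G b' a ≡ true
  NB : (Fin (n G) → Fin 2) → Fin (n G) → Fin (n G) → Set
  NB side a a' = ∀ b → side b ≡ suc zero → adj G a b ≡ true → adj G a' b ≡ true

H′ : Digraph₂
H′ zero (suc zero) = true
H′ _ _ = false

module Submission where

-- (⇐) In K_{i₁} ∘_H ⋯ ∘_H K_{iₘ} every vertex is joined to the earlier
-- vertices exactly as H prescribes: vertices at positions p < q are
-- adjacent iff H(part p, part q) (`positional-threshold`).  For H′ the two
-- parts are independent and an A-vertex a is adjacent to a B-vertex b iff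
-- a precedes b, so the neighbourhoods on each side are nested by position.
--
-- (⇒) Induction on the number of vertices, working with graphs on Fin k
-- carrying a labelling by {A,B} (`Labelled`).  A difference graph has a
-- vertex v that may be added last (`addable-vertex`): an isolated A-vertex,
-- or else a B-vertex with maximal neighbourhood, which is then adjacent to
-- all of A.  Deleting v leaves a difference graph, and a threshold
-- construction of G − v extended by K_{label v} constructs G (`Extension`).

open import Defs hiding (sym; irrefl)
open import Data.Bool using (Bool; true; false; _∧_; _∨_)
open import Data.Bool.Properties using (∨-identityʳ; ∧-identityʳ; ∧-zeroʳ; T-≡)
  renaming (_≟_ to _≟ᵇ_)
open import Data.Empty using (⊥-elim)
open import Data.Fin using (Fin; zero; suc; toℕ; splitAt; _↑ˡ_; _↑ʳ_; punchIn; punchOut)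
open import Data.Fin.Properties
  using (splitAt-↑ˡ; splitAt-↑ʳ; splitAt⁻¹-↑ˡ; splitAt⁻¹-↑ʳ; toℕ-↑ˡ; toℕ-↑ʳ; toℕ<n;
         punchInᵢ≢i; punchIn-punchOut; punchOut-punchIn; punchOut-cong; any?)
  renaming (_≟_ to _≟ᶠ_)
open import Data.List using (List; []; _∷_; _∷ʳ_; foldl)
open import Data.List.Properties using (foldl-∷ʳ)
open import Data.Nat using (ℕ; zero; suc; _+_; _<_; _≤_; _<ᵇ_; s≤s)
open import Data.Nat.Properties
  using (<ᵇ⇒<; <⇒<ᵇ; ≤-total; ≤-refl; <-≤-trans; ≤-<-trans; <⇒≤; +-identityʳ)
open import Data.Product using (Σ; ∃; _×_; _,_; proj₁; proj₂)
open import Data.Sum using (_⊎_; inj₁; inj₂)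
import Data.Sum as Sum
open import Function using (_∘_)
open import Function.Bundles using (_⇔_; mk⇔; _⤖_; Bijection; Inverse; Equivalence; mk↔ₛ′)
open import Function.Construct.Identity using (⤖-id)
open import Function.Properties.Bijection using (⤖⇒↔)
open import Function.Properties.Inverse using (↔⇒⤖)
open import Relation.Nullary using (¬_; Dec; yes; no)
open import Relation.Nullary.Decidable using (_×-dec_)
open import Relation.Binary.PropositionalEquality using (_≡_; refl; sym; trans; cong; subst)

<ᵇ-true : ∀ {i j} → i < j → (i <ᵇ j) ≡ true
<ᵇ-true i<j = Equivalence.to T-≡ (<⇒<ᵇ i<j)

<ᵇ-false : ∀ {i j} → j ≤ i → (i <ᵇ j) ≡ false
<ᵇ-false {j = zero}                  _         = refl
<ᵇ-false {i = suc i} {j = suc j} (s≤s j≤i) = <ᵇ-false {i} {j} j≤i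

<ᵇ-sound : ∀ {i j} → (i <ᵇ j) ≡ true → i < j
<ᵇ-sound {i} {j} e = <ᵇ⇒< i j (Equivalence.from T-≡ e)

<ᵇ-weakenʳ : ∀ {i j k} → j ≤ k → (i <ᵇ j) ≡ true → (i <ᵇ k) ≡ true
<ᵇ-weakenʳ j≤k e = <ᵇ-true (<-≤-trans (<ᵇ-sound e) j≤k)

<ᵇ-weakenˡ : ∀ {i j k} → i ≤ j → (j <ᵇ k) ≡ true → (i <ᵇ k) ≡ true
<ᵇ-weakenˡ {j = j} {k} i≤j e = <ᵇ-true (≤-<-trans i≤j (<ᵇ-sound {j} {k} e))

data Summand (m n : ℕ) : Fin (m + n) → Set where
  left  : ∀ u → Summand m n (u ↑ˡ n)
  right : ∀ v → Summand m n (m ↑ʳ v)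

summand : ∀ m n x → Summand m n x
summand m n x with splitAt m {n} x in eq
... | inj₁ u = subst (Summand m n) (splitAt⁻¹-↑ˡ eq) (left u)
... | inj₂ v = subst (Summand m n) (splitAt⁻¹-↑ʳ eq) (right v)

module _ (H : Digraph₂) (G F : PGraph) where
  private
    Q : PGraph
    Q = compose H G F

  part-left : ∀ u → part Q (u ↑ˡ size F) ≡ part G u
  part-left u rewrite splitAt-↑ˡ (size G) u (size F) = refl

  part-right : ∀ v → part Q (size G ↑ʳ v) ≡ part F v
  part-right v rewrite splitAt-↑ʳ (size G) (size F) v = refl

  adj-left-left : ∀ u u' → padj Q (u ↑ˡ size F) (u' ↑ˡ size F) ≡ padj G u u'
  adj-left-left u u' rewrite splitAt-↑ˡ (size G) u (size F) | splitAt-↑ˡ (size G) u' (size F) = refl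

  adj-right-right : ∀ v v' → padj Q (size G ↑ʳ v) (size G ↑ʳ v') ≡ padj F v v'
  adj-right-right v v' rewrite splitAt-↑ʳ (size G) (size F) v | splitAt-↑ʳ (size G) (size F) v' = refl

  adj-left-right : ∀ u v → padj Q (u ↑ˡ size F) (size G ↑ʳ v) ≡ H (part G u) (part F v)
  adj-left-right u v rewrite splitAt-↑ˡ (size G) u (size F) | splitAt-↑ʳ (size G) (size F) v = refl

  adj-right-left : ∀ u v → padj Q (size G ↑ʳ v) (u ↑ˡ size F) ≡ H (part G u) (part F v)
  adj-right-left u v rewrite splitAt-↑ˡ (size G) u (size F) | splitAt-↑ʳ (size G) (size F) v = refl

threshold-∷ʳ : ∀ H is i → threshold H (is ∷ʳ i) ≡ compose H (threshold H is) (K i)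
threshold-∷ʳ H is i = foldl-∷ʳ (λ acc j → compose H acc (K j)) Empty i is

-- (⇐)  Threshold graphs are determined by the positions of their vertices.

orderAdj : Digraph₂ → Fin 2 → Fin 2 → ℕ → ℕ → Bool
orderAdj H p q i j = (H p q ∧ (i <ᵇ j)) ∨ (H q p ∧ (j <ᵇ i))

orderAdj-< : ∀ H p q {i j} → i < j → orderAdj H p q i j ≡ H p q
orderAdj-< H p q i<j
  rewrite <ᵇ-true i<j | <ᵇ-false (<⇒≤ i<j) | ∧-identityʳ (H p q) | ∧-zeroʳ (H q p)
  = ∨-identityʳ (H p q)

orderAdj-> : ∀ H p q {i j} → j < i → orderAdj H p q i j ≡ H q p
orderAdj-> H p q j<i
  rewrite <ᵇ-true j<i | <ᵇ-false (<⇒≤ j<i) | ∧-zeroʳ (H p q) = ∧-identityʳ (H q p)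

orderAdj-≡ : ∀ H p q i → orderAdj H p q i i ≡ false
orderAdj-≡ H p q i rewrite <ᵇ-false (≤-refl {i}) | ∧-zeroʳ (H p q) | ∧-zeroʳ (H q p) = refl

Positional : Digraph₂ → PGraph → Set
Positional H P = ∀ x y → padj P x y ≡ orderAdj H (part P x) (part P y) (toℕ x) (toℕ y)

toℕ-last : ∀ m → toℕ (m ↑ʳ zero {0}) ≡ m
toℕ-last m = trans (toℕ-↑ʳ m zero) (+-identityʳ m)

-- Appending one vertex keeps the positional description, since the new
-- vertex comes after all the old ones.
positional-step : ∀ H P i → Positional H P → Positional H (compose H P (K i))
positional-step H P i pos x y with summand (size P) 1 x | summand (size P) 1 y
... | left u | left u'
  rewrite adj-left-left H P (K i) u u' | part-left H P (K i) u | part-left H P (K i) u'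
        | toℕ-↑ˡ u 1 | toℕ-↑ˡ u' 1
  = pos u u'
... | left u | right zero
  rewrite adj-left-right H P (K i) u zero | part-left H P (K i) u | part-right H P (K i) zero
        | toℕ-↑ˡ u 1 | toℕ-last (size P)
  = sym (orderAdj-< H (part P u) i (toℕ<n u))
... | right zero | left u
  rewrite adj-right-left H P (K i) u zero | part-left H P (K i) u | part-right H P (K i) zero
        | toℕ-↑ˡ u 1 | toℕ-last (size P)
  = sym (orderAdj-> H i (part P u) (toℕ<n u))
... | right zero | right zero
  rewrite adj-right-right H P (K i) zero zero | part-right H P (K i) zero
  = sym (orderAdj-≡ H i i (toℕ (size P ↑ʳ zero {0})))

positional-foldl : ∀ H P is → Positional H P →
                   Positional H (foldl (λ acc i → compose H acc (K i)) P is)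
positional-foldl H P []       pos = pos
positional-foldl H P (i ∷ is) pos =
  positional-foldl H (compose H P (K i)) is (positional-step H P i pos)

positional-threshold : ∀ H is → Positional H (threshold H is)
positional-threshold H is = positional-foldl H Empty is (λ ())

H′-within : ∀ p i j → orderAdj H′ p p i j ≡ false
H′-within zero       i j = refl
H′-within (suc zero) i j = refl

H′-across : ∀ i j → orderAdj H′ zero (suc zero) i j ≡ (i <ᵇ j)
H′-across i j = ∨-identityʳ (i <ᵇ j)

-- The bipartition is given by the parts; neighbourhoods are nested because an
-- A–B edge exists exactly when the A-vertex precedes the B-vertex.
threshold⇒difference : (G : Graph) → IsThreshold H′ G → IsDifference G
threshold⇒difference G (is , f , f-adj) =
  side , independent ,
  (λ b b' sb sb' → Sum.map (later-B-sees-more sb sb') (later-B-sees-more sb' sb)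
                           (≤-total (pos b) (pos b'))) ,
  (λ a a' sa sa' → Sum.swap (Sum.map (earlier-A-sees-more sa sa') (earlier-A-sees-more sa' sa)
                                     (≤-total (pos a) (pos a'))))
  where
  P : PGraph
  P = threshold H′ is

  side : Fin (n G) → Fin 2
  side x = part P (Bijection.to f x)

  pos : Fin (n G) → ℕ
  pos x = toℕ (Bijection.to f x)

  adj-by-position : ∀ x y → adj G x y ≡ orderAdj H′ (side x) (side y) (pos x) (pos y)
  adj-by-position x y = trans (f-adj x y) (positional-threshold H′ is _ _)

  independent : ∀ x y → side x ≡ side y → adj G x y ≡ false
  independent x y same rewrite adj-by-position x y | same = H′-within (side y) (pos x) (pos y)

  across : ∀ {a b} → side a ≡ zero → side b ≡ suc zero → adj G a b ≡ (pos a <ᵇ pos b)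
  across {a} {b} sa sb rewrite adj-by-position a b | sa | sb = H′-across (pos a) (pos b)

  later-B-sees-more : ∀ {b b'} → side b ≡ suc zero → side b' ≡ suc zero → pos b ≤ pos b' →
    ∀ a → side a ≡ zero → adj G b a ≡ true → adj G b' a ≡ true
  later-B-sees-more {b} {b'} sb sb' b≤b' a sa ba =
    trans (Graph.sym G b' a)
      (trans (across sa sb') (<ᵇ-weakenʳ b≤b' (trans (sym (across sa sb)) (trans (Graph.sym G a b) ba))))

  earlier-A-sees-more : ∀ {a a'} → side a ≡ zero → side a' ≡ zero → pos a ≤ pos a' →
    ∀ b → side b ≡ suc zero → adj G a' b ≡ true → adj G a b ≡ true
  earlier-A-sees-more {a} {a'} sa sa' a≤a' b sb a'b =
    trans (across sa sb) (<ᵇ-weakenˡ {k = pos b} a≤a' (trans (sym (across sa' sb)) a'b))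

-- (⇒)  Difference graphs are threshold graphs.

record Labelled (k : ℕ) : Set where
  field
    E        : Fin k → Fin k → Bool
    E-sym    : ∀ x y → E x y ≡ E y x
    E-irrefl : ∀ x → E x x ≡ false
    label    : Fin k → Fin 2

open Labelled

delete : ∀ {k} → Labelled (suc k) → Fin (suc k) → Labelled k
delete L v = record
  { E        = λ x y → E L (punchIn v x) (punchIn v y)
  ; E-sym    = λ x y → E-sym L (punchIn v x) (punchIn v y)
  ; E-irrefl = λ x → E-irrefl L (punchIn v x)
  ; label    = label L ∘ punchIn v
  }

A-neighbours⊆ : ∀ {k} (L : Labelled k) → Fin k → Fin k → Set
A-neighbours⊆ L b b' = ∀ a → label L a ≡ zero → E L b a ≡ true → E L b' a ≡ true

-- The labels form a bipartition whose B-side neighbourhoods are nested.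
record Nested {k} (L : Labelled k) : Set where
  field
    independent : ∀ x y → label L x ≡ label L y → E L x y ≡ false
    B-nested    : ∀ b b' → label L b ≡ suc zero → label L b' ≡ suc zero →
                  A-neighbours⊆ L b b' ⊎ A-neighbours⊆ L b' b

open Nested

delete-nested : ∀ {k} (L : Labelled (suc k)) → Nested L → ∀ v → Nested (delete L v)
delete-nested L N v = record
  { independent = λ x y → independent N (punchIn v x) (punchIn v y)
  ; B-nested    = λ b b' sb sb' →
      Sum.map (λ ⊆ a → ⊆ (punchIn v a)) (λ ⊆ a → ⊆ (punchIn v a))
              (B-nested N (punchIn v b) (punchIn v b') sb sb')
  }

record Realization {k} (L : Labelled k) (P : PGraph) : Set where
  field
    iso              : Fin k ⤖ Fin (size P)
    label-preserved  : ∀ x → part P (Bijection.to iso x) ≡ label L x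
    edges-preserved  : ∀ x y → E L x y ≡ padj P (Bijection.to iso x) (Bijection.to iso y)

open Realization

-- v may be added last to an H-threshold construction of the rest:
-- its adjacency to each other vertex is dictated by H and the labels.
Addable : ∀ {k} → Digraph₂ → Labelled k → Fin k → Set
Addable H L v = ∀ y → E L y v ≡ H (label L y) (label L v)

maximum-or-empty : ∀ {k} (S : Fin k → Set) → (∀ x → Dec (S x)) → (R : Fin k → Fin k → Set) →
  (∀ {x y z} → R x y → R y z → R x z) → (∀ x y → S x → S y → R x y ⊎ R y x) →
  (∀ x → ¬ S x) ⊎ ∃ λ m → S m × (∀ x → S x → R x m)
maximum-or-empty {zero} S S? R R-trans R-total = inj₁ λ ()
maximum-or-empty {suc k} S S? R R-trans R-total
  with maximum-or-empty (S ∘ suc) (S? ∘ suc) (λ x y → R (suc x) (suc y)) R-trans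
                        (λ x y → R-total (suc x) (suc y))
     | S? zero
... | inj₁ none | no ¬s0 = inj₁ λ { zero → ¬s0 ; (suc x) → none x }
... | inj₁ none | yes s0 =
  inj₂ (zero , s0 , λ { zero _ → Sum.reduce (R-total zero zero s0 s0)
                     ; (suc x) sx → ⊥-elim (none x sx) })
... | inj₂ (m , sm , max) | no ¬s0 =
  inj₂ (suc m , sm , λ { zero s0 → ⊥-elim (¬s0 s0) ; (suc x) sx → max x sx })
... | inj₂ (m , sm , max) | yes s0 with R-total zero (suc m) s0 sm
...   | inj₁ 0≤m = inj₂ (suc m , sm , λ { zero _ → 0≤m ; (suc x) sx → max x sx })
...   | inj₂ m≤0 =
  inj₂ (zero , s0 , λ { zero _ → Sum.reduce (R-total zero zero s0 s0)
                     ; (suc x) sx → R-trans (max x sx) m≤0 })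

H′-into-A : ∀ p → H′ p zero ≡ false
H′-into-A zero       = refl
H′-into-A (suc zero) = refl

label-cases : (p : Fin 2) → p ≡ zero ⊎ p ≡ suc zero
label-cases zero       = inj₁ refl
label-cases (suc zero) = inj₂ refl

module _ {k} (L : Labelled (suc k)) (N : Nested L) where

  neighbour-of-A-is-B : ∀ x y → E L x y ≡ true → label L x ≡ zero → label L y ≡ suc zero
  neighbour-of-A-is-B x y xy lx with label-cases (label L y)
  ... | inj₂ ly = ly
  ... | inj₁ ly with () ← trans (sym xy) (independent N x y (trans lx (sym ly)))

  -- Without B-vertices the graph is edgeless, so any vertex can go last.
  addable-if-no-B : (∀ x → ¬ label L x ≡ suc zero) → Addable H′ L zero
  addable-if-no-B noB y with label-cases (label L y) | label-cases (label L zero)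
  ... | inj₂ ly | _       = ⊥-elim (noB y ly)
  ... | _       | inj₂ l0 = ⊥-elim (noB zero l0)
  ... | inj₁ ly | inj₁ l0 rewrite ly | l0 = independent N y zero (trans ly (sym l0))

  module _ (m : Fin (suc k)) (lm : label L m ≡ suc zero)
           (max : ∀ b → label L b ≡ suc zero → A-neighbours⊆ L b m) where

    -- An A-vertex missed by the maximal B-vertex is isolated.
    addable-if-missed : ∀ a → label L a ≡ zero → E L m a ≡ false → Addable H′ L a
    addable-if-missed a la ma y rewrite la = trans isolated (sym (H′-into-A (label L y)))
      where
      isolated : E L y a ≡ false
      isolated with E L y a in ya
      ... | false = refl
      ... | true with () ← trans (sym ma)
              (max y (neighbour-of-A-is-B a y (trans (E-sym L a y) ya) la) a la ya)

    addable-if-universal : (∀ a → label L a ≡ zero → E L m a ≡ true) → Addable H′ L m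
    addable-if-universal universal y with label-cases (label L y)
    ... | inj₁ ly rewrite ly | lm = trans (E-sym L y m) (universal y ly)
    ... | inj₂ ly rewrite ly = independent N y m (trans ly (sym lm))

  addable-vertex : Σ (Fin (suc k)) (Addable H′ L)
  addable-vertex
    with maximum-or-empty (λ b → label L b ≡ suc zero) (λ b → label L b ≟ᶠ suc zero)
           (A-neighbours⊆ L) (λ b⊆b' b'⊆b'' a la ba → b'⊆b'' a la (b⊆b' a la ba)) (B-nested N)
  ... | inj₁ noB = zero , addable-if-no-B noB
  ... | inj₂ (m , lm , max) with any? (λ a → (label L a ≟ᶠ zero) ×-dec (E L m a ≟ᵇ false))
  ...   | yes (a , la , ma) = a , addable-if-missed m lm max a la ma
  ...   | no  no-missed     = m , addable-if-universal m lm max universal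
    where
    universal : ∀ a → label L a ≡ zero → E L m a ≡ true
    universal a la with E L m a in ma
    ... | true  = refl
    ... | false = ⊥-elim (no-missed (a , la , ma))

data Punctured {k} (v : Fin (suc k)) : Fin (suc k) → Set where
  at-v  : Punctured v v
  other : ∀ w → Punctured v (punchIn v w)

punctured : ∀ {k} (v x : Fin (suc k)) → Punctured v x
punctured v x with v ≟ᶠ x
... | yes refl = at-v
... | no  v≢x  = subst (Punctured v) (punchIn-punchOut v≢x) (other (punchOut v≢x))

module Extension (H : Digraph₂) {k} (L : Labelled (suc k)) (v : Fin (suc k))
                 (v-addable : Addable H L v) (P : PGraph) (R : Realization (delete L v) P) where

  Q : PGraph
  Q = compose H P (K (label L v))

  to : Fin k → Fin (size P)
  to = Bijection.to (iso R)

  from : Fin (size P) → Fin k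
  from = Inverse.from (⤖⇒↔ (iso R))

  new : Fin (size Q)
  new = size P ↑ʳ zero

  embed′ : (x : Fin (suc k)) → Dec (v ≡ x) → Fin (size Q)
  embed′ x (yes _)   = new
  embed′ x (no  v≢x) = to (punchOut v≢x) ↑ˡ 1

  embed : Fin (suc k) → Fin (size Q)
  embed x = embed′ x (v ≟ᶠ x)

  restore′ : Fin (size P) ⊎ Fin 1 → Fin (suc k)
  restore′ (inj₁ u) = punchIn v (from u)
  restore′ (inj₂ _) = v

  restore : Fin (size Q) → Fin (suc k)
  restore y = restore′ (splitAt (size P) y)

  embed-v : embed v ≡ new
  embed-v with v ≟ᶠ v
  ... | yes _   = refl
  ... | no  v≢v = ⊥-elim (v≢v refl)

  embed-other : ∀ w → embed (punchIn v w) ≡ to w ↑ˡ 1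
  embed-other w with v ≟ᶠ punchIn v w
  ... | yes v≡w = ⊥-elim (punchInᵢ≢i v w (sym v≡w))
  ... | no  v≢w = cong (λ z → to z ↑ˡ 1) (trans (punchOut-cong v refl) (punchOut-punchIn v))

  restore-embed : ∀ x → restore (embed x) ≡ x
  restore-embed x with punctured v x
  ... | at-v    rewrite embed-v = cong restore′ (splitAt-↑ʳ (size P) 1 zero)
  ... | other w rewrite embed-other w | splitAt-↑ˡ (size P) (to w) 1 =
    cong (punchIn v) (Inverse.strictlyInverseʳ (⤖⇒↔ (iso R)) w)

  embed-restore : ∀ y → embed (restore y) ≡ y
  embed-restore y with summand (size P) 1 y
  ... | left u rewrite splitAt-↑ˡ (size P) u 1 =
    trans (embed-other (from u)) (cong (_↑ˡ 1) (Inverse.strictlyInverseˡ (⤖⇒↔ (iso R)) u))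
  ... | right zero rewrite splitAt-↑ʳ (size P) 1 (zero {0}) = embed-v

  labels : ∀ x → part Q (embed x) ≡ label L x
  labels x with punctured v x
  ... | at-v    rewrite embed-v = part-right H P (K (label L v)) zero
  ... | other w rewrite embed-other w =
    trans (part-left H P (K (label L v)) (to w)) (label-preserved R w)

  edge-to-v : ∀ w → E L (punchIn v w) v ≡ H (part P (to w)) (label L v)
  edge-to-v w = trans (v-addable (punchIn v w)) (cong (λ p → H p (label L v)) (sym (label-preserved R w)))

  edges : ∀ x y → E L x y ≡ padj Q (embed x) (embed y)
  edges x y with punctured v x | punctured v y
  ... | at-v | at-v rewrite embed-v =
    trans (E-irrefl L v) (sym (adj-right-right H P (K (label L v)) zero zero))
  ... | other w | other w' rewrite embed-other w | embed-other w' =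
    trans (edges-preserved R w w') (sym (adj-left-left H P (K (label L v)) (to w) (to w')))
  ... | other w | at-v rewrite embed-other w | embed-v =
    trans (edge-to-v w) (sym (adj-left-right H P (K (label L v)) (to w) zero))
  ... | at-v | other w rewrite embed-other w | embed-v =
    trans (E-sym L v (punchIn v w))
          (trans (edge-to-v w) (sym (adj-right-left H P (K (label L v)) (to w) zero)))

  realization : Realization L Q
  realization = record
    { iso             = ↔⇒⤖ (mk↔ₛ′ embed restore embed-restore restore-embed)
    ; label-preserved = labels
    ; edges-preserved = edges
    }

realize : ∀ k (L : Labelled k) → Nested L → ∃ λ is → Realization L (threshold H′ is)
realize zero    L N = [] , record { iso = ⤖-id (Fin 0) ; label-preserved = λ () ; edges-preserved = λ () }
realize (suc k) L N =
  rest ∷ʳ label L v ,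
  subst (Realization L) (sym (threshold-∷ʳ H′ rest (label L v)))
        (Extension.realization H′ L v v-addable (threshold H′ rest) rest-realized)
  where
  v : Fin (suc k)
  v = proj₁ (addable-vertex L N)

  v-addable : Addable H′ L v
  v-addable = proj₂ (addable-vertex L N)

  rest : List (Fin 2)
  rest = proj₁ (realize k (delete L v) (delete-nested L N v))

  rest-realized : Realization (delete L v) (threshold H′ rest)
  rest-realized = proj₂ (realize k (delete L v) (delete-nested L N v))

difference⇒threshold : (G : Graph) → IsDifference G → IsThreshold H′ G
difference⇒threshold G (side , independent , B-nested , _) =
  is , iso realized , edges-preserved realized
  where
  L : Labelled (n G)
  L = record { E = adj G ; E-sym = Graph.sym G ; E-irrefl = Graph.irrefl G ; label = side }

  constructed : ∃ λ is → Realization L (threshold H′ is)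
  constructed = realize (n G) L (record { independent = independent ; B-nested = B-nested })

  is : List (Fin 2)
  is = proj₁ constructed

  realized : Realization L (threshold H′ is)
  realized = proj₂ constructed

corollary2 : (G : Graph) → IsDifference G ⇔ IsThreshold H′ G
corollary2 G = mk⇔ (difference⇒threshold G) (threshold⇒difference G)
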